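{- Let $a\ge b\ge c\ge 2$ be integers, $n=a+b+c-1$, and let $I\vDash n$ be a composition with $w_I>0$ and $\Theta^+_{\overline I}(a)=0$. Then \[c'_I:=\sum_{k=2}^{c}\Theta_I^+(k)-\sum_{k=a}^{a+c-2}\Theta^-_{\overline{\varphi(I)}}(k)+\Delta_I(b+c-1)\ \ge\ \Delta_I(b+c-1).\]
   Context: A composition $I=i_1\cdots i_z\vDash n$ is a sequence of positive integers with sum $n$; $\overline I=i_z\cdots i_1$; $|i_1\cdots i_k|=i_1+\dots+i_k$. $w_I=i_1(i_2-1)\cdots(i_z-1)$. $\Theta_I^+(x)=\min\{|i_1\cdots i_k|:0\le k\le z,\ |i_1\cdots i_k|\ge x\}-x$; $\Theta_I^-(x)=x-\max\{|i_1\cdots i_k|:0\le k\le z,\ |i_1\cdots i_k|\le x\}$. $e_2(x_1,\dots,x_m)=\sum_{i<j}x_ix_j$. For $1\le m\le n-1$ define $p,s,q,t$ by $m=i_1+\dots+i_{p-1}+s=i_2+\dots+i_q+t$, $1\le p,q\le z$, $1\le s\le i_p$, $1\le t\le i_{q+1}$, with $i_{z+1}=i_1$; $\Delta_I(m)=s(i_p-s-i_1)$ if $i_1\le i_p-s$, else $\Delta_I(m)=e_2(i_p-s,i_{p+1},\dots,i_q,t)$. $\varphi$: write $I=PQ$ with $Q$ the shortest suffix of $I$ with $|Q|\ge a$; $\varphi(I)=I$ if $Q=I$, otherwise $\varphi(I)=i_1\,\overline{P\backslash i_1}\,Q$ where $P\backslash i_1$ is $P$ with its first part removed. -}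

module Defs where

open import Data.Nat using (ℕ; zero; suc; _+_; _*_; _∸_; _≤_; _<_; _≤ᵇ_; _⊓_; _⊔_)
open import Data.Nat.ListAction using (sum; product)
open import Data.List using (List; []; _∷_; _++_; [_]; map; reverse; scanl; take; drop; foldr; applyUpTo)
open import Data.List.Relation.Unary.All using (All)
open import Data.Product using (_×_; _,_)
open import Data.Bool using (if_then_else_)
open import Data.Integer using (ℤ; +_; _-_) renaming (_+_ to _+ℤ_)

IsComposition : ℕ → List ℕ → Set
IsComposition n I = All (λ i → 0 < i) I × sum I ≡ n
  where open import Relation.Binary.PropositionalEquality using (_≡_)

-- w_I = i_1 (i_2 - 1) ... (i_z - 1)   (empty composition: unused, set to 0)
w : List ℕ → ℕ
w []       = 0
w (i ∷ is) = i * product (map (λ j → j ∸ 1) is)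

partials : List ℕ → List ℕ
partials I = scanl _+_ 0 I

minGE : ℕ → ℕ → List ℕ → ℕ
minGE x d ps = foldr (λ p acc → if x ≤ᵇ p then p ⊓ acc else acc) d ps

-- max { p ∈ ps : p ≤ x }, default 0 (0 is always a partial sum)
maxLE : ℕ → List ℕ → ℕ
maxLE x ps = foldr (λ p acc → if p ≤ᵇ x then p ⊔ acc else acc) 0 ps

-- Θ⁺_I(x) = min{ |i_1..i_k| ≥ x } - x   (only meaningful for x ≤ |I|;
-- default x ⊔ |I| ≥ every partial sum; for x > |I| this makes Θ⁺ = 0, never used)
Θ⁺ : List ℕ → ℕ → ℕ
Θ⁺ I x = minGE x (x ⊔ sum I) (partials I) ∸ x

Θ⁻ : List ℕ → ℕ → ℕ
Θ⁻ I x = x ∸ maxLE x (partials I)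

e₂ : List ℕ → ℕ
e₂ []       = 0
e₂ (x ∷ xs) = x * sum xs + e₂ xs

-- 1-based indexing i_k (default 0 out of range)
part : List ℕ → ℕ → ℕ
part []       _             = 0
part (i ∷ is) zero          = 0
part (i ∷ is) (suc zero)    = i
part (i ∷ is) (suc (suc k)) = part is (suc k)

-- locate m I = (p , s) with m = i_1 + ... + i_{p-1} + s, 1 ≤ s ≤ i_p  (for 1 ≤ m ≤ |I|)
locate : ℕ → List ℕ → ℕ × ℕ
locate m []       = 0 , m
locate m (i ∷ is) with m ≤ᵇ i
... | Data.Bool.true  = 1 , m
... | Data.Bool.false with locate (m ∸ i) is
...   | p , s = suc p , s

rotate : List ℕ → List ℕ
rotate []       = []
rotate (i ∷ is) = is ++ [ i ]

first : List ℕ → ℕ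
first []      = 0
first (i ∷ _) = i

-- Δ_I(m) for 1 ≤ m ≤ n-1:
--   m = i_1+...+i_{p-1}+s = i_2+...+i_q+t, 1 ≤ s ≤ i_p, 1 ≤ t ≤ i_{q+1} (i_{z+1} = i_1)
--   Δ = s(i_p - s - i_1)                       if i_1 ≤ i_p - s
--   Δ = e_2(i_p - s, i_{p+1}, ..., i_q, t)     otherwise
Δ : List ℕ → ℕ → ℕ
Δ I m with locate m I | locate m (rotate I)
... | p , s | q , t =
  if first I ≤ᵇ (part I p ∸ s)
  then s * (part I p ∸ s ∸ first I)
  else e₂ ((part I p ∸ s) ∷ take (q ∸ p) (drop p I) ++ [ t ])

-- I = P Q with Q the shortest suffix of I with |Q| ≥ a
splitSuffix : ℕ → List ℕ → List ℕ × List ℕ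
splitSuffix a []       = [] , []
splitSuffix a (x ∷ xs) with a ≤ᵇ sum xs
... | Data.Bool.true with splitSuffix a xs
...   | P , Q = x ∷ P , Q
splitSuffix a (x ∷ xs) | Data.Bool.false = [] , x ∷ xs

φ : ℕ → List ℕ → List ℕ
φ a I with splitSuffix a I
... | []      , Q = I
... | i₁ ∷ P' , Q = i₁ ∷ (reverse P' ++ Q)

-- Σ_{k=lo}^{hi} f k  (empty if hi < lo)
sumFromTo : ℕ → ℕ → (ℕ → ℕ) → ℕ
sumFromTo lo hi f = sum (applyUpTo (λ j → f (lo + j)) (suc hi ∸ lo))

c′ : ℕ → ℕ → ℕ → List ℕ → ℤ
c′ a b c I =
  ((+ sumFromTo 2 c (Θ⁺ I)) - (+ sumFromTo a (a + c ∸ 2) (Θ⁻ (reverse (φ a I)))))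
  +ℤ (+ Δ I (b + c ∸ 1))

-- Since a is a partial sum of the reversal of I, I = P Q with |Q| = a; write P = i₁ P'.
-- Then the reversal of φ(I) is (reverse Q) P' i₁, so Θ⁻ of it at a + j is the distance from j
-- down to a partial sum of P' i₁, while Θ⁺_I(2 + j) is the distance up to a partial sum of
-- i₁ P Q. A part x covered completely contributes x(x-1)/2 to both sums (0, ..., x-1 against
-- x-1, ..., 0); in a partially covered part Θ⁻ counts up from 0 while Θ⁺ counts down from the
-- end of the part, and superadditivity of x(x-1)/2 absorbs the misalignment caused by the
-- first part i₁. So the Θ⁻-sum in c′_I is at most the Θ⁺-sum.

module Submission where

open import Defs
open import Data.Nat using (ℕ; zero; suc; _+_; _∸_; _≤_; _<_; _≤?_; _<?_; _≤ᵇ_; _⊔_; z≤n; s≤s; s≤s⁻¹)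
open import Data.Nat.Properties
open import Data.Nat.ListAction using (sum)
open import Data.Nat.ListAction.Properties using (sum-++; sum-↭)
open import Data.List using (List; []; _∷_; _++_; [_]; reverse; scanl; applyUpTo)
open import Data.List.Properties using (reverse-++; unfold-reverse; reverse-involutive; ++-assoc)
open import Data.List.Relation.Binary.Permutation.Propositional.Properties using (↭-reverse)
open import Data.List.Relation.Unary.All using (All; []; _∷_)
open import Data.List.Relation.Unary.All.Properties using (++⁻ʳ)
open import Data.Bool using (true; false)
open import Data.Bool.Properties using (T-≡; ¬-not)
open import Data.Product using (_×_; _,_; ∃-syntax)
open import Data.Integer using (+_; _-_; +≤+) renaming (_≤_ to _≤ℤ_; _+_ to _+ℤ_)
import Data.Integer.Properties as ℤ
open import Function.Bundles using (Equivalence)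
open import Relation.Nullary using (yes; no)
open import Relation.Nullary.Negation using (contradiction)
open import Relation.Binary.PropositionalEquality hiding ([_])

open Equivalence using (to; from)

sumBelow : ℕ → (ℕ → ℕ) → ℕ
sumBelow n f = sum (applyUpTo f n)

sumBelow-cong : ∀ n {f g : ℕ → ℕ} → (∀ i → i < n → f i ≡ g i) → sumBelow n f ≡ sumBelow n g
sumBelow-cong zero    f≡g = refl
sumBelow-cong (suc n) f≡g = cong₂ _+_ (f≡g 0 (s≤s z≤n)) (sumBelow-cong n (λ i i<n → f≡g (suc i) (s≤s i<n)))

sumBelow-mono : ∀ n {f g : ℕ → ℕ} → (∀ i → i < n → f i ≤ g i) → sumBelow n f ≤ sumBelow n g
sumBelow-mono zero    f≤g = z≤n
sumBelow-mono (suc n) f≤g = +-mono-≤ (f≤g 0 (s≤s z≤n)) (sumBelow-mono n (λ i i<n → f≤g (suc i) (s≤s i<n)))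

sumBelow-+ : ∀ m n f → sumBelow (m + n) f ≡ sumBelow m f + sumBelow n (λ i → f (m + i))
sumBelow-+ zero    n f = refl
sumBelow-+ (suc m) n f =
  trans (cong (_+_ (f 0)) (sumBelow-+ m n (λ i → f (suc i)))) (sym (+-assoc (f 0) _ _))

sumBelow-suc : ∀ n f → sumBelow (suc n) f ≡ sumBelow n f + f n
sumBelow-suc zero    f = +-identityʳ (f 0)
sumBelow-suc (suc n) f =
  trans (cong (_+_ (f 0)) (sumBelow-suc n (λ i → f (suc i)))) (sym (+-assoc (f 0) _ _))

sumBelow-reverse : ∀ n f → sumBelow n f ≡ sumBelow n (λ i → f (n ∸ suc i))
sumBelow-reverse zero    f = refl
sumBelow-reverse (suc n) f = begin
  f 0 + sumBelow n (λ i → f (suc i))          ≡⟨ cong (_+_ (f 0)) (sumBelow-reverse n (λ i → f (suc i))) ⟩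
  f 0 + sumBelow n (λ i → f (suc (n ∸ suc i))) ≡⟨ cong (_+_ (f 0)) (sumBelow-cong n (λ i i<n → cong f (sym (+-∸-assoc 1 i<n)))) ⟩
  f 0 + sumBelow n (λ i → f (n ∸ i))          ≡⟨ +-comm (f 0) _ ⟩
  sumBelow n (λ i → f (n ∸ i)) + f 0          ≡⟨ cong (λ k → sumBelow n (λ i → f (n ∸ i)) + f k) (n∸n≡0 n) ⟨
  sumBelow n (λ i → f (n ∸ i)) + f (n ∸ n)    ≡⟨ sumBelow-suc n (λ i → f (n ∸ i)) ⟨
  sumBelow (suc n) (λ i → f (n ∸ i))          ∎
  where open ≡-Reasoning

triangle : ℕ → ℕ
triangle n = sumBelow n (λ i → i)

triangle-countdown : ∀ n → sumBelow n (λ i → n ∸ suc i) ≡ triangle n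
triangle-countdown n = sym (sumBelow-reverse n (λ i → i))

triangle-+ : ∀ m n → triangle (m + n) ≡ sumBelow m (λ i → m + n ∸ suc i) + triangle n
triangle-+ m n = begin
  triangle (m + n)                                       ≡⟨ triangle-countdown (m + n) ⟨
  sumBelow (m + n) (λ i → m + n ∸ suc i)                 ≡⟨ sumBelow-+ m n (λ i → m + n ∸ suc i) ⟩
  sumBelow m (λ i → m + n ∸ suc i)
    + sumBelow n (λ i → m + n ∸ suc (m + i))             ≡⟨ cong (_+_ (sumBelow m (λ i → m + n ∸ suc i))) tail ⟩
  sumBelow m (λ i → m + n ∸ suc i) + triangle n          ∎
  where
  open ≡-Reasoning
  tail : sumBelow n (λ i → m + n ∸ suc (m + i)) ≡ triangle n
  tail = trans (sumBelow-cong n (λ i _ → trans (cong (m + n ∸_) (sym (+-suc m i))) ([m+n]∸[m+o]≡n∸o m n (suc i))))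
               (triangle-countdown n)

triangle-superadditive : ∀ m n → triangle m + triangle n ≤ triangle (m + n)
triangle-superadditive m n = begin
  triangle m + triangle n                                ≡⟨ cong (_+ triangle n) (triangle-countdown m) ⟨
  sumBelow m (λ i → m ∸ suc i) + triangle n              ≤⟨ +-monoˡ-≤ (triangle n) (sumBelow-mono m (λ i _ → ∸-monoˡ-≤ (suc i) (m≤m+n m n))) ⟩
  sumBelow m (λ i → m + n ∸ suc i) + triangle n          ≡⟨ triangle-+ m n ⟨
  triangle (m + n)                                       ∎
  where open ≤-Reasoning

-- Structurally recursive forms of Θ⁺ and Θ⁻ (see Θ⁺≡θ⁺ and Θ⁻≡θ⁻).
θ⁺ : List ℕ → ℕ → ℕ
θ⁺ []       y       = 0
θ⁺ (x ∷ xs) zero    = 0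
θ⁺ (x ∷ xs) (suc y) with suc y ≤? x
... | yes _ = x ∸ suc y
... | no  _ = θ⁺ xs (suc y ∸ x)

θ⁻ : List ℕ → ℕ → ℕ
θ⁻ []       j = j
θ⁻ (x ∷ xs) j with j <? x
... | yes _ = j
... | no  _ = θ⁻ xs (j ∸ x)

θ⁺-zero : ∀ X → θ⁺ X 0 ≡ 0
θ⁺-zero []      = refl
θ⁺-zero (_ ∷ _) = refl

θ⁺-within : ∀ {x} xs {y} → suc y ≤ x → θ⁺ (x ∷ xs) (suc y) ≡ x ∸ suc y
θ⁺-within {x} xs {y} y<x with suc y ≤? x
... | yes _   = refl
... | no  y≮x = contradiction y<x y≮x

θ⁺-beyond : ∀ {x} xs {y} → x < y → θ⁺ (x ∷ xs) y ≡ θ⁺ xs (y ∸ x)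
θ⁺-beyond {x} xs {suc y} x<y with suc y ≤? x
... | yes y≤x = contradiction y≤x (<⇒≱ x<y)
... | no  _   = refl

θ⁻-within : ∀ {x} xs {j} → j < x → θ⁻ (x ∷ xs) j ≡ j
θ⁻-within {x} xs {j} j<x with j <? x
... | yes _   = refl
... | no  j≮x = contradiction j<x j≮x

θ⁻-beyond : ∀ {x} xs {j} → x ≤ j → θ⁻ (x ∷ xs) j ≡ θ⁻ xs (j ∸ x)
θ⁻-beyond {x} xs {j} x≤j with j <? x
... | yes j<x = contradiction x≤j (<⇒≱ j<x)
... | no  _   = refl

θ⁻-≤ : ∀ X j → θ⁻ X j ≤ j
θ⁻-≤ []       j = ≤-refl
θ⁻-≤ (x ∷ xs) j with j <? x
... | yes _ = ≤-refl
... | no  _ = ≤-trans (θ⁻-≤ xs (j ∸ x)) (m∸n≤m j x)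

θ⁺-++ : ∀ X Y {y} → y ≤ sum X → θ⁺ (X ++ Y) y ≡ θ⁺ X y
θ⁺-++ []       Y y≤0 rewrite n≤0⇒n≡0 y≤0 = θ⁺-zero Y
θ⁺-++ (x ∷ xs) Y {zero}  _ = refl
θ⁺-++ (x ∷ xs) Y {suc y} y≤ with suc y ≤? x
... | yes _ = refl
... | no  _ = θ⁺-++ xs Y (m≤n+o⇒m∸n≤o (suc y) x y≤)

θ⁻-++ˡ : ∀ X Y {j} → j < sum X → θ⁻ (X ++ Y) j ≡ θ⁻ X j
θ⁻-++ˡ (x ∷ xs) Y {j} j< with j <? x
... | yes _   = refl
... | no  j≮x = θ⁻-++ˡ xs Y (subst (j ∸ x <_) (m+n∸m≡n x (sum xs)) (∸-monoˡ-< j< (≮⇒≥ j≮x)))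

θ⁻-++ʳ : ∀ X Y k → θ⁻ (X ++ Y) (sum X + k) ≡ θ⁻ Y k
θ⁻-++ʳ []       Y k = refl
θ⁻-++ʳ (x ∷ xs) Y k = begin
  θ⁻ (x ∷ xs ++ Y) (x + sum xs + k)   ≡⟨ θ⁻-beyond (xs ++ Y) (≤-trans (m≤m+n x (sum xs)) (m≤m+n _ k)) ⟩
  θ⁻ (xs ++ Y) (x + sum xs + k ∸ x)   ≡⟨ cong (θ⁻ (xs ++ Y)) (trans (cong (_∸ x) (+-assoc x (sum xs) k)) (m+n∸m≡n x _)) ⟩
  θ⁻ (xs ++ Y) (sum xs + k)           ≡⟨ θ⁻-++ʳ xs Y k ⟩
  θ⁻ Y k                              ∎
  where open ≡-Reasoning

≤ᵇ-true : ∀ {m n} → m ≤ n → (m ≤ᵇ n) ≡ true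
≤ᵇ-true m≤n = to T-≡ (≤⇒≤ᵇ m≤n)

≤ᵇ-false : ∀ {m n} → n < m → (m ≤ᵇ n) ≡ false
≤ᵇ-false {m} {n} n<m = ¬-not (λ m≤ᵇn → <⇒≱ n<m (≤ᵇ⇒≤ m n (from T-≡ m≤ᵇn)))

scanl-≥ : ∀ {y z} X → y ≤ z → All (y ≤_) (scanl _+_ z X)
scanl-≥         []      y≤z = y≤z ∷ []
scanl-≥ {z = z} (x ∷ X) y≤z = y≤z ∷ scanl-≥ X (≤-trans y≤z (m≤m+n z x))

minGE-glb : ∀ k {d y} ps → y ≤ d → All (y ≤_) ps → y ≤ minGE k d ps
minGE-glb k []       y≤d []           = y≤d
minGE-glb k (p ∷ ps) y≤d (y≤p ∷ y≤ps) with k ≤ᵇ p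
... | true  = ⊓-glb y≤p (minGE-glb k ps y≤d y≤ps)
... | false = minGE-glb k ps y≤d y≤ps

minGE-scanl-start : ∀ X {z k} → k ≤ z → minGE k (k ⊔ (z + sum X)) (scanl _+_ z X) ≡ z
minGE-scanl-start []      {z} {k} k≤z rewrite ≤ᵇ-true k≤z =
  m≤n⇒m⊓n≡m (≤-trans (m≤m+n z 0) (m≤n⊔m k (z + 0)))
minGE-scanl-start (x ∷ X) {z} {k} k≤z rewrite ≤ᵇ-true k≤z =
  m≤n⇒m⊓n≡m (minGE-glb k (scanl _+_ (z + x) X) (≤-trans (m≤m+n z _) (m≤n⊔m k _)) (scanl-≥ X (m≤m+n z x)))

-- k is not replaced by z + suc t because the default k ⊔ … of minGE stays fixed
-- along the recursion, while z and t change.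
minGE-scanl : ∀ X {z t k} → k ≡ z + suc t →
  minGE k (k ⊔ (z + sum X)) (scanl _+_ z X) ≡ k + θ⁺ X (suc t)
minGE-scanl []      {z} {t} {k} refl rewrite ≤ᵇ-false (m<m+n z {suc t} (s≤s z≤n)) =
  trans (m≥n⇒m⊔n≡m (+-monoʳ-≤ z z≤n)) (sym (+-identityʳ k))
minGE-scanl (x ∷ X) {z} {t} {k} k≡
  rewrite ≤ᵇ-false {k} {z} (subst (z <_) (sym k≡) (m<m+n z {suc t} (s≤s z≤n)))
        | sym (+-assoc z x (sum X))
  with suc t ≤? x
... | yes t<x = begin
  minGE k (k ⊔ (z + x + sum X)) (scanl _+_ (z + x) X)  ≡⟨ minGE-scanl-start X (subst (_≤ z + x) (sym k≡) (+-monoʳ-≤ z t<x)) ⟩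
  z + x                                                 ≡⟨ cong (_+_ z) (m+[n∸m]≡n t<x) ⟨
  z + (suc t + (x ∸ suc t))                             ≡⟨ +-assoc z (suc t) _ ⟨
  z + suc t + (x ∸ suc t)                               ≡⟨ cong (_+ (x ∸ suc t)) k≡ ⟨
  k + (x ∸ suc t)                                       ∎
  where open ≡-Reasoning
... | no t≮x = trans (minGE-scanl X k≡′) (cong (λ v → k + θ⁺ X v) (sym (+-∸-assoc 1 x≤t)))
  where
  x≤t : x ≤ t
  x≤t = s≤s⁻¹ (≰⇒> t≮x)
  k≡′ : k ≡ z + x + suc (t ∸ x)
  k≡′ = begin
    k                       ≡⟨ k≡ ⟩
    z + suc t               ≡⟨ cong (λ v → z + suc v) (m+[n∸m]≡n x≤t) ⟨
    z + suc (x + (t ∸ x))   ≡⟨ cong (_+_ z) (+-suc x _) ⟨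
    z + (x + suc (t ∸ x))   ≡⟨ +-assoc z x _ ⟨
    z + x + suc (t ∸ x)     ∎
    where open ≡-Reasoning

Θ⁺≡θ⁺ : ∀ X y → Θ⁺ X y ≡ θ⁺ X y
Θ⁺≡θ⁺ X zero    = trans (minGE-scanl-start X z≤n) (sym (θ⁺-zero X))
Θ⁺≡θ⁺ X (suc t) = trans (cong (_∸ suc t) (minGE-scanl X {z = 0} refl)) (m+n∸m≡n (suc t) _)

maxLE-none : ∀ {k} ps → All (k <_) ps → maxLE k ps ≡ 0
maxLE-none []       []           = refl
maxLE-none (p ∷ ps) (k<p ∷ k<ps) rewrite ≤ᵇ-false k<p = maxLE-none ps k<ps

maxLE-scanl : ∀ X {z k} → z ≤ k → maxLE k (scanl _+_ z X) ≡ k ∸ θ⁻ X (k ∸ z)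
maxLE-scanl []      {z} {k} z≤k rewrite ≤ᵇ-true z≤k = trans (⊔-identityʳ z) (sym (m∸[m∸n]≡n z≤k))
maxLE-scanl (x ∷ X) {z} {k} z≤k rewrite ≤ᵇ-true z≤k with k ∸ z <? x
... | yes k∸z<x = trans (cong (_⊔_ z) (maxLE-none (scanl _+_ (z + x) X) (scanl-≥ X k<z+x)))
                        (trans (⊔-identityʳ z) (sym (m∸[m∸n]≡n z≤k)))
  where
  k<z+x : suc k ≤ z + x
  k<z+x = subst (_≤ z + x) (trans (+-suc z (k ∸ z)) (cong suc (m+[n∸m]≡n z≤k))) (+-monoʳ-≤ z k∸z<x)
... | no  k∸z≮x = trans (cong (_⊔_ z) (maxLE-scanl X z+x≤k))
                        (trans (m≤n⇒m⊔n≡n z≤) (cong (λ v → k ∸ θ⁻ X v) (sym (∸-+-assoc k z x))))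
  where
  z+x≤k : z + x ≤ k
  z+x≤k = subst (z + x ≤_) (m+[n∸m]≡n z≤k) (+-monoʳ-≤ z (≮⇒≥ k∸z≮x))
  z≤ : z ≤ k ∸ θ⁻ X (k ∸ (z + x))
  z≤ = ≤-trans (m≤m+n z x) (subst (_≤ k ∸ θ⁻ X (k ∸ (z + x))) (m∸[m∸n]≡n z+x≤k)
                                   (∸-monoʳ-≤ k (θ⁻-≤ X (k ∸ (z + x)))))

Θ⁻≡θ⁻ : ∀ X k → Θ⁻ X k ≡ θ⁻ X k
Θ⁻≡θ⁻ X k = trans (cong (k ∸_) (maxLE-scanl X z≤n)) (m∸[m∸n]≡n (θ⁻-≤ X k))

θ⁺≡0⇒partialSum : ∀ X y → θ⁺ X (suc y) ≡ 0 → suc y ≤ sum X →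
  ∃[ X₁ ] ∃[ X₂ ] (X ≡ X₁ ++ X₂ × sum X₁ ≡ suc y)
θ⁺≡0⇒partialSum (x ∷ xs) y θ≡0 y<ΣX with suc y ≤? x
... | yes y<x = [ x ] , xs , refl , trans (+-identityʳ x) (≤-antisym (m∸n≡0⇒m≤n θ≡0) y<x)
... | no  y≮x =
  let X₁ , X₂ , xs≡ , ΣX₁ = θ⁺≡0⇒partialSum xs (y ∸ x) (subst (λ v → θ⁺ xs v ≡ 0) shift θ≡0)
                              (subst (_≤ sum xs) shift (m≤n+o⇒m∸n≤o (suc y) x y<ΣX))
  in x ∷ X₁ , X₂ , cong (x ∷_) xs≡ , trans (cong (_+_ x) ΣX₁) (trans (+-suc x _) (cong suc (m+[n∸m]≡n x≤y)))
  where
  x≤y : x ≤ y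
  x≤y = s≤s⁻¹ (≰⇒> y≮x)
  shift : suc y ∸ x ≡ suc (y ∸ x)
  shift = +-∸-assoc 1 x≤y

sum-reverse : ∀ xs → sum (reverse xs) ≡ sum xs
sum-reverse xs = sum-↭ (↭-reverse xs)

Θ⁺-reverse≡0⇒suffix : ∀ I {a} → 0 < a → a ≤ sum I → Θ⁺ (reverse I) a ≡ 0 →
  ∃[ P ] ∃[ Q ] (I ≡ P ++ Q × sum Q ≡ a)
Θ⁺-reverse≡0⇒suffix I {suc t} _ a≤ΣI Θ⁺≡0 =
  let X₁ , X₂ , rev≡ , ΣX₁ = θ⁺≡0⇒partialSum (reverse I) t (trans (sym (Θ⁺≡θ⁺ (reverse I) (suc t))) Θ⁺≡0)
                               (subst (suc t ≤_) (sym (sum-reverse I)) a≤ΣI)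
  in reverse X₂ , reverse X₁
   , trans (sym (reverse-involutive I)) (trans (cong reverse rev≡) (reverse-++ X₁ X₂))
   , trans (sum-reverse X₁) ΣX₁

splitSuffix-++ : ∀ {a} P q Q → 0 < q → q + sum Q ≡ a → splitSuffix a (P ++ q ∷ Q) ≡ (P , q ∷ Q)
splitSuffix-++ {a} [] q Q 0<q ΣqQ rewrite ≤ᵇ-false {a} {sum Q} (subst (sum Q <_) ΣqQ (+-monoˡ-≤ (sum Q) 0<q)) = refl
splitSuffix-++ {a} (x ∷ P) q Q 0<q ΣqQ
  rewrite ≤ᵇ-true {a} {sum (P ++ q ∷ Q)} (subst₂ _≤_ ΣqQ (sym (sum-++ P (q ∷ Q))) (m≤n+m _ (sum P)))
        | splitSuffix-++ P q Q 0<q ΣqQ = refl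

reverse-φ-++ : ∀ {a} i₁ P q Q → 0 < q → q + sum Q ≡ a →
  reverse (φ a (i₁ ∷ P ++ q ∷ Q)) ≡ reverse (q ∷ Q) ++ P ++ [ i₁ ]
reverse-φ-++ {a} i₁ P q Q 0<q ΣqQ rewrite splitSuffix-++ (i₁ ∷ P) q Q 0<q ΣqQ = begin
  reverse (i₁ ∷ reverse P ++ q ∷ Q)           ≡⟨ unfold-reverse i₁ (reverse P ++ q ∷ Q) ⟩
  reverse (reverse P ++ q ∷ Q) ++ [ i₁ ]      ≡⟨ cong (_++ [ i₁ ]) (reverse-++ (reverse P) (q ∷ Q)) ⟩
  (reverse (q ∷ Q) ++ reverse (reverse P)) ++ [ i₁ ] ≡⟨ cong (λ v → (reverse (q ∷ Q) ++ v) ++ [ i₁ ]) (reverse-involutive P) ⟩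
  (reverse (q ∷ Q) ++ P) ++ [ i₁ ]            ≡⟨ ++-assoc (reverse (q ∷ Q)) P [ i₁ ] ⟩
  reverse (q ∷ Q) ++ P ++ [ i₁ ]              ∎
  where open ≡-Reasoning

sumθ⁻-∷ : ∀ x xs n → sumBelow (x + n) (θ⁻ (x ∷ xs)) ≡ triangle x + sumBelow n (θ⁻ xs)
sumθ⁻-∷ x xs n = trans (sumBelow-+ x n (θ⁻ (x ∷ xs))) (cong₂ _+_
  (sumBelow-cong x (λ i i<x → θ⁻-within xs i<x))
  (sumBelow-cong n (λ i _ → trans (θ⁻-beyond xs (m≤m+n x i)) (cong (θ⁻ xs) (m+n∸m≡n x i)))))

sumθ⁺-within : ∀ {x} xs {m} → m ≤ x → sumBelow m (λ y → θ⁺ (x ∷ xs) (suc y)) ≡ sumBelow m (λ y → x ∸ suc y)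
sumθ⁺-within xs {m} m≤x = sumBelow-cong m (λ y y<m → θ⁺-within xs (≤-trans y<m m≤x))

sumθ⁺-∷ : ∀ x xs n → sumBelow (x + n) (λ y → θ⁺ (x ∷ xs) (suc y)) ≡ triangle x + sumBelow n (λ y → θ⁺ xs (suc y))
sumθ⁺-∷ x xs n = trans (sumBelow-+ x n (λ y → θ⁺ (x ∷ xs) (suc y))) (cong₂ _+_
  (trans (sumθ⁺-within {x} xs ≤-refl) (triangle-countdown x))
  (sumBelow-cong n (λ i _ → trans (θ⁺-beyond xs (s≤s (m≤m+n x i)))
                                  (cong (θ⁺ xs) (trans (cong (_∸ x) (sym (+-suc x i))) (m+n∸m≡n x (suc i)))))))

sumθ⁻-bound-inside : ∀ {x} xs M D → M + D ≤ x →
  sumBelow (M + D) (θ⁻ (x ∷ xs)) ≤ sumBelow M (λ y → x ∸ suc y) + triangle D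
sumθ⁻-bound-inside {x} xs M D M+D≤x = begin
  sumBelow (M + D) (θ⁻ (x ∷ xs))                 ≡⟨ sumBelow-cong (M + D) (λ i i< → θ⁻-within xs (≤-trans i< M+D≤x)) ⟩
  triangle (M + D)                               ≡⟨ triangle-+ M D ⟩
  sumBelow M (λ y → M + D ∸ suc y) + triangle D  ≤⟨ +-monoˡ-≤ (triangle D) (sumBelow-mono M (λ y _ → ∸-monoˡ-≤ (suc y) M+D≤x)) ⟩
  sumBelow M (λ y → x ∸ suc y) + triangle D      ∎
  where open ≤-Reasoning

sumθ⁻-bound-across : ∀ xs M u R →
  sumBelow (M + (u + R)) (θ⁻ (M + u ∷ xs)) ≤ sumBelow M (λ y → M + u ∸ suc y) + triangle (u + R)
sumθ⁻-bound-across xs M u R = begin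
  sumBelow (M + (u + R)) (θ⁻ (M + u ∷ xs))                  ≡⟨ cong (λ n → sumBelow n (θ⁻ (M + u ∷ xs))) (+-assoc M u R) ⟨
  sumBelow (M + u + R) (θ⁻ (M + u ∷ xs))                    ≡⟨ sumθ⁻-∷ (M + u) xs R ⟩
  triangle (M + u) + sumBelow R (θ⁻ xs)                      ≤⟨ +-monoʳ-≤ (triangle (M + u)) (sumBelow-mono R (λ i _ → θ⁻-≤ xs i)) ⟩
  triangle (M + u) + triangle R                              ≡⟨ cong (_+ triangle R) (triangle-+ M u) ⟩
  sumBelow M (λ y → M + u ∸ suc y) + triangle u + triangle R ≡⟨ +-assoc _ (triangle u) (triangle R) ⟩
  sumBelow M (λ y → M + u ∸ suc y) + (triangle u + triangle R) ≤⟨ +-monoʳ-≤ _ (triangle-superadditive u R) ⟩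
  sumBelow M (λ y → M + u ∸ suc y) + triangle (u + R)        ∎
  where open ≤-Reasoning

sumθ⁻-bound-head : ∀ {x} xs M D → M ≤ x →
  sumBelow (M + D) (θ⁻ (x ∷ xs)) ≤ sumBelow M (λ y → x ∸ suc y) + triangle D
sumθ⁻-bound-head {x} xs M D M≤x with M + D ≤? x | m≤n⇒∃[o]m+o≡n M≤x
... | yes M+D≤x | _        = sumθ⁻-bound-inside xs M D M+D≤x
... | no  M+D≰x | u , refl with m≤n⇒∃[o]m+o≡n (<⇒≤ (≰⇒> M+D≰x))
...   | R , M+u+R≡M+D with +-cancelˡ-≡ M D (u + R) (trans (sym M+u+R≡M+D) (+-assoc M u R))
...     | refl = sumθ⁻-bound-across xs M u R

-- The window of θ⁻ is D positions longer than that of θ⁺; triangle D pays for the extra positions.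
sumθ⁻≤sumθ⁺+triangle : ∀ P M D → M + D ≤ sum P →
  sumBelow (M + D) (θ⁻ P) ≤ sumBelow M (λ y → θ⁺ P (suc y)) + triangle D
sumθ⁻≤sumθ⁺+triangle []       M D M+D≤0 rewrite n≤0⇒n≡0 M+D≤0 = z≤n
sumθ⁻≤sumθ⁺+triangle (x ∷ xs) M D M+D≤ with x ≤? M
... | no x≰M = subst (λ s → sumBelow (M + D) (θ⁻ (x ∷ xs)) ≤ s + triangle D)
                     (sym (sumθ⁺-within xs M≤x)) (sumθ⁻-bound-head xs M D M≤x)
  where
  M≤x : M ≤ x
  M≤x = <⇒≤ (≰⇒> x≰M)
... | yes x≤M with m≤n⇒∃[o]m+o≡n x≤M
...   | M′ , refl = begin
  sumBelow (x + M′ + D) (θ⁻ (x ∷ xs))                       ≡⟨ cong (λ n → sumBelow n (θ⁻ (x ∷ xs))) (+-assoc x M′ D) ⟩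
  sumBelow (x + (M′ + D)) (θ⁻ (x ∷ xs))                     ≡⟨ sumθ⁻-∷ x xs (M′ + D) ⟩
  triangle x + sumBelow (M′ + D) (θ⁻ xs)                    ≤⟨ +-monoʳ-≤ (triangle x) (sumθ⁻≤sumθ⁺+triangle xs M′ D M′+D≤) ⟩
  triangle x + (sumBelow M′ (λ y → θ⁺ xs (suc y)) + triangle D) ≡⟨ +-assoc (triangle x) _ (triangle D) ⟨
  triangle x + sumBelow M′ (λ y → θ⁺ xs (suc y)) + triangle D   ≡⟨ cong (_+ triangle D) (sumθ⁺-∷ x xs M′) ⟨
  sumBelow (x + M′) (λ y → θ⁺ (x ∷ xs) (suc y)) + triangle D    ∎
  where
  open ≤-Reasoning
  M′+D≤ : M′ + D ≤ sum xs
  M′+D≤ = +-cancelˡ-≤ x _ _ (subst (_≤ x + sum xs) (+-assoc x M′ D) M+D≤)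

-- On the θ⁺ side the first part i₁ = D + 1 is met at offset 2, contributing D - 1, ..., 0,
-- that is triangle D: exactly the allowance in sumθ⁻≤sumθ⁺+triangle.
sumθ⁻-rotate≤sumθ⁺ : ∀ N i₁ P Q → 0 < i₁ → N + N ≤ i₁ + sum P →
  sumBelow N (θ⁻ (P ++ [ i₁ ])) ≤ sumBelow N (λ j → θ⁺ (i₁ ∷ P ++ Q) (2 + j))
sumθ⁻-rotate≤sumθ⁺ N i₁ P Q _ _ with N <? i₁
... | yes N<i₁ = begin
  sumBelow N (θ⁻ (P ++ [ i₁ ]))                 ≤⟨ sumBelow-mono N (λ j _ → θ⁻-≤ (P ++ [ i₁ ]) j) ⟩
  triangle N                                   ≡⟨ triangle-countdown N ⟨
  sumBelow N (λ j → N ∸ suc j)                 ≤⟨ sumBelow-mono N (λ j _ → ∸-monoˡ-≤ (2 + j) N<i₁) ⟩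
  sumBelow N (λ j → i₁ ∸ (2 + j))              ≡⟨ sumBelow-cong N (λ j j<N → θ⁺-within (P ++ Q) (≤-trans (s≤s j<N) N<i₁)) ⟨
  sumBelow N (λ j → θ⁺ (i₁ ∷ P ++ Q) (2 + j))  ∎
  where open ≤-Reasoning
sumθ⁻-rotate≤sumθ⁺ N (suc D) P Q _ N+N≤ | no N≮i₁ with m≤n⇒∃[o]m+o≡n (≤-trans (n≤1+n D) (≮⇒≥ N≮i₁))
... | M , refl = begin
  sumBelow (D + M) (θ⁻ (P ++ [ suc D ]))                    ≡⟨ sumBelow-cong (D + M) (λ j j< → θ⁻-++ˡ P [ suc D ] (≤-trans j< N≤ΣP)) ⟩
  sumBelow (D + M) (θ⁻ P)                                   ≡⟨ cong (λ n → sumBelow n (θ⁻ P)) (+-comm D M) ⟩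
  sumBelow (M + D) (θ⁻ P)                                   ≤⟨ sumθ⁻≤sumθ⁺+triangle P M D (subst (_≤ sum P) (+-comm D M) N≤ΣP) ⟩
  sumBelow M (λ y → θ⁺ P (suc y)) + triangle D              ≡⟨ +-comm _ (triangle D) ⟩
  triangle D + sumBelow M (λ y → θ⁺ P (suc y))              ≡⟨ cong₂ _+_ (sym within) (sym beyond) ⟩
  sumBelow D g + sumBelow M (λ y → g (D + y))               ≡⟨ sumBelow-+ D M g ⟨
  sumBelow (D + M) g                                        ∎
  where
  open ≤-Reasoning
  g : ℕ → ℕ
  g j = θ⁺ (suc D ∷ P ++ Q) (2 + j)
  N≤ΣP : D + M ≤ sum P
  N≤ΣP = +-cancelˡ-≤ (D + M) _ _ (≤-trans N+N≤ (+-monoˡ-≤ (sum P) (≮⇒≥ N≮i₁)))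
  within : sumBelow D g ≡ triangle D
  within = trans (sumBelow-cong D (λ j j<D → θ⁺-within (P ++ Q) (s≤s j<D))) (triangle-countdown D)
  beyond : sumBelow M (λ y → g (D + y)) ≡ sumBelow M (λ y → θ⁺ P (suc y))
  beyond = sumBelow-cong M (λ y y<M → begin-equality
    θ⁺ (suc D ∷ P ++ Q) (2 + (D + y))   ≡⟨ θ⁺-beyond (P ++ Q) (s≤s (s≤s (m≤m+n D y))) ⟩
    θ⁺ (P ++ Q) (suc (D + y) ∸ D)      ≡⟨ cong (λ v → θ⁺ (P ++ Q) (v ∸ D)) (+-suc D y) ⟨
    θ⁺ (P ++ Q) (D + suc y ∸ D)        ≡⟨ cong (θ⁺ (P ++ Q)) (m+n∸m≡n D (suc y)) ⟩
    θ⁺ (P ++ Q) (suc y)                ≡⟨ θ⁺-++ P Q (≤-trans y<M (≤-trans (m≤n+m M D) N≤ΣP)) ⟩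
    θ⁺ P (suc y)                       ∎)

sumΘ⁻∘φ-++≤sumΘ⁺ : ∀ {a} N P Q → All (0 <_) (P ++ Q) → sum Q ≡ a → 0 < a → N + N < sum P →
  sumBelow N (λ j → Θ⁻ (reverse (φ a (P ++ Q))) (a + j)) ≤ sumBelow N (λ j → Θ⁺ (P ++ Q) (2 + j))
sumΘ⁻∘φ-++≤sumΘ⁺ N (i₁ ∷ P) (q ∷ Q) (0<i₁ ∷ pos) refl _ N+N<ΣP = begin
  sumBelow N (λ j → Θ⁻ (reverse (φ (q + sum Q) I)) (q + sum Q + j)) ≡⟨ sumBelow-cong N (λ j _ → Θ⁻-φ j) ⟩
  sumBelow N (θ⁻ (P ++ [ i₁ ]))                          ≤⟨ sumθ⁻-rotate≤sumθ⁺ N i₁ P (q ∷ Q) 0<i₁ (<⇒≤ N+N<ΣP) ⟩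
  sumBelow N (λ j → θ⁺ I (2 + j))                        ≡⟨ sumBelow-cong N (λ j _ → Θ⁺≡θ⁺ I (2 + j)) ⟨
  sumBelow N (λ j → Θ⁺ I (2 + j))                        ∎
  where
  open ≤-Reasoning
  I : List ℕ
  I = i₁ ∷ P ++ q ∷ Q
  0<q : 0 < q
  0<q with ++⁻ʳ P pos
  ... | 0<q ∷ _ = 0<q
  Θ⁻-φ : ∀ j → Θ⁻ (reverse (φ (q + sum Q) I)) (q + sum Q + j) ≡ θ⁻ (P ++ [ i₁ ]) j
  Θ⁻-φ j = begin-equality
    Θ⁻ (reverse (φ (q + sum Q) I)) (q + sum Q + j)               ≡⟨ Θ⁻≡θ⁻ (reverse (φ (q + sum Q) I)) (q + sum Q + j) ⟩
    θ⁻ (reverse (φ (q + sum Q) I)) (q + sum Q + j)               ≡⟨ cong (λ X → θ⁻ X (q + sum Q + j)) (reverse-φ-++ i₁ P q Q 0<q refl) ⟩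
    θ⁻ (reverse (q ∷ Q) ++ P ++ [ i₁ ]) (q + sum Q + j)          ≡⟨ cong (λ s → θ⁻ (reverse (q ∷ Q) ++ P ++ [ i₁ ]) (s + j)) (sum-reverse (q ∷ Q)) ⟨
    θ⁻ (reverse (q ∷ Q) ++ P ++ [ i₁ ]) (sum (reverse (q ∷ Q)) + j) ≡⟨ θ⁻-++ʳ (reverse (q ∷ Q)) (P ++ [ i₁ ]) j ⟩
    θ⁻ (P ++ [ i₁ ]) j                                           ∎

sumΘ⁻∘φ≤sumΘ⁺ : ∀ {a} N I → All (0 <_) I → 0 < a → N + N + a < sum I → Θ⁺ (reverse I) a ≡ 0 →
  sumBelow N (λ j → Θ⁻ (reverse (φ a I)) (a + j)) ≤ sumBelow N (λ j → Θ⁺ I (2 + j))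
sumΘ⁻∘φ≤sumΘ⁺ {a} N I pos 0<a N+N+a<ΣI Θ⁺≡0
  with Θ⁺-reverse≡0⇒suffix I 0<a (≤-trans (m≤n+m a (N + N)) (<⇒≤ N+N+a<ΣI)) Θ⁺≡0
... | P , Q , refl , ΣQ = sumΘ⁻∘φ-++≤sumΘ⁺ N P Q pos ΣQ 0<a
  (+-cancelʳ-< a (N + N) (sum P) (subst (N + N + a <_) (trans (sum-++ P Q) (cong (_+_ (sum P)) ΣQ)) N+N+a<ΣI))

sumFromTo-length : ∀ a c₀ f → sumFromTo a (a + suc (suc c₀) ∸ 2) f ≡ sumBelow (suc c₀) (λ j → f (a + j))
sumFromTo-length a c₀ f rewrite +-suc a (suc c₀) | +-suc a c₀ | sym (+-suc a c₀) | m+n∸m≡n a (suc c₀) = refl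

composition-length : ∀ a b c₀ → a + b + suc (suc c₀) ∸ 1 ≡ b + suc c₀ + a
composition-length a b c₀ = begin
  a + b + suc (suc c₀) ∸ 1    ≡⟨ cong (_∸ 1) (+-suc (a + b) (suc c₀)) ⟩
  a + b + suc c₀              ≡⟨ +-assoc a b (suc c₀) ⟩
  a + (b + suc c₀)            ≡⟨ +-comm a _ ⟩
  b + suc c₀ + a              ∎
  where open ≡-Reasoning

i≤[m-n]+i : ∀ {m n} i → n ≤ m → (+ i) ≤ℤ ((+ m) - (+ n)) +ℤ (+ i)
i≤[m-n]+i {m} {n} i n≤m rewrite ℤ.m-n≡m⊖n m n | ℤ.⊖-≥ n≤m = +≤+ (m≤n+m i (m ∸ n))

lemma3p4 : (a b c : ℕ) → b ≤ a → c ≤ b → 2 ≤ c →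
    (I : List ℕ) → IsComposition (a + b + c ∸ 1) I →
    0 < w I → Θ⁺ (reverse I) a ≡ 0 →
    (+ Δ I (b + c ∸ 1)) ≤ℤ c′ a b c I
lemma3p4 _ _ 0       _ _ ()
lemma3p4 _ _ 1       _ _ (s≤s ())
lemma3p4 a b (suc (suc c₀)) b≤a c≤b _ I (pos , ΣI) _ Θ⁺≡0 = i≤[m-n]+i (Δ I (b + suc (suc c₀) ∸ 1)) (begin
  sumFromTo a (a + suc (suc c₀) ∸ 2) (Θ⁻ (reverse (φ a I)))  ≡⟨ sumFromTo-length a c₀ (Θ⁻ (reverse (φ a I))) ⟩
  sumBelow N (λ j → Θ⁻ (reverse (φ a I)) (a + j))           ≤⟨ sumΘ⁻∘φ≤sumΘ⁺ N I pos 0<a N+N+a<ΣI Θ⁺≡0 ⟩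
  sumBelow N (λ j → Θ⁺ I (2 + j))                           ∎)
  where
  open ≤-Reasoning
  N : ℕ
  N = suc c₀
  0<a : 0 < a
  0<a = ≤-trans (s≤s z≤n) (≤-trans c≤b b≤a)
  N+N+a<ΣI : N + N + a < sum I
  N+N+a<ΣI = subst (N + N + a <_) (sym (trans ΣI (composition-length a b c₀)))
                   (+-monoˡ-< a (+-monoˡ-< N c≤b))
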